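{- For all processes $p,q$ of $\mathrm{CLL}_R$: (1) $p\vee q\in F$ iff $p\in F$ and $q\in F$; (2) $\alpha.p\in F$ iff $p\in F$, for each $\alpha\in Act_\tau$; (3) for $\odot\in\{\Box,\parallel_A\}$, $p\odot q\in F$ iff $p\in F$ or $q\in F$; (4) if $p\in F$ or $q\in F$ then $p\wedge q\in F$; (5) $0\notin F$ and $\bot\in F$; (6) $\langle X|X=\tau.X\rangle\in F$; (7) if every $q$ with $p\stackrel{\epsilon}{\Longrightarrow}|q$ satisfies $q\in F$, then $p\in F$; (8) for every recursive specification $E$ and every equation $X=t_X\in E$, $\langle X|E\rangle\in F$ iff $\langle t_X|E\rangle\in F$.
   Context: Fix a set $Act$ of visible actions and let $Act_\tau=Act\cup\{\tau\}$; $a$ ranges over $Act$, $\alpha$ over $Act_\tau$. Terms of $\mathrm{CLL}_R$: $t::=0\mid\bot\mid\alpha.t\mid t\Box t\mid t\wedge t\mid t\vee t\mid t\parallel_A t\mid X\mid\langle X|E\rangle$, where $X$ is a variable, $A\subseteq Act$, and $E$ is a recursive specification, i.e. a finite nonempty set of equations $\{Y=t_Y:Y\in V\}$ over a set $V$ of variables with $X\in V$ (variables of $V$ are bound in $\langle X|E\rangle$; recursive variables of distinct specifications are distinct and never occur free). $\langle X|X=t\rangle$ abbreviates $\langle X|\{X=t\}\rangle$. A process is a closed term. For $E$ over $V$, $\langle t|E\rangle$ is $t$ with every free occurrence of each $Y\in V$ replaced by $\langle Y|E\rangle$. All recursive specifications are assumed guarded: every occurrence of every $Y\in V$ in every right-hand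 side of $E$ lies within a subterm $\alpha.t'$ or $t_1\vee t_2$. Transitions $\stackrel{\alpha}{\longrightarrow}$ and the inconsistency predicate $F$ are given by the unique stable model of the following stratified transition system specification ($x\not\stackrel{\alpha}{\longrightarrow}$: no $\alpha$-transition; $z\stackrel{\epsilon}{\Longrightarrow}|y$: $z(\stackrel{\tau}{\longrightarrow})^*y$ and $y\not\stackrel{\tau}{\longrightarrow}$, no consistency requirement). Operational rules: $\alpha.x\stackrel{\alpha}{\to}x$; if $x_1\stackrel{a}{\to}y_1$, $x_2\not\stackrel{\tau}{\to}$ then $x_1\Box x_2\stackrel a\to y_1$ and $x_2\Box x_1\stackrel a\to y_1$; if $x_1\stackrel\tau\to y_1$ then $x_1\Box x_2\stackrel\tau\to y_1\Box x_2$, $x_2\Box x_1\stackrel\tau\to x_2\Box y_1$, $x_1\wedge x_2\stackrel\tau\to y_1\wedge x_2$, $x_2\wedge x_1\stackrel\tau\to x_2\wedge y_1$, $x_1\parallel_A x_2\stackrel\tau\to y_1\parallel_A x_2$, $x_2\parallel_A x_1\stackrel\tau\to x_2\parallel_A y_1$; if $x_1\stackrel a\to y_1$, $x_2\stackrel a\to y_2$ then $x_1\wedge x_2\stackrel a\to y_1\wedge y_2$, and if also $a\in A$ then $x_1\parallel_A x_2\stackrel a\to y_1\parallel_A y_2$; if $a\notin A$, $x_1\stackrel a\to y_1$, $x_2\not\stackrel\tau\to$ then $x_1\parallel_A x_2\stackrel a\to y_1\parallel_A x_2$ and $x_2\parallel_A x_1\stackrel a\to x_2\parallel_A y_1$;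 $x_1\vee x_2\stackrel\tau\to x_1$, $x_1\vee x_2\stackrel\tau\to x_2$; if $Y=t_Y\in E$ and $\langle t_Y|E\rangle\stackrel\alpha\to y$ then $\langle Y|E\rangle\stackrel\alpha\to y$. Predicate rules: $\bot\in F$; $x\in F\Rightarrow\alpha.x\in F$; $x_1,x_2\in F\Rightarrow x_1\vee x_2\in F$; if $x_1\in F$ or $x_2\in F$ then $x_1\Box x_2, x_1\parallel_A x_2, x_1\wedge x_2\in F$; if $x_1\wedge x_2\not\stackrel\tau\to$ and one of $x_1,x_2$ has an $a$-transition while the other has none, then $x_1\wedge x_2\in F$; if $x_1\wedge x_2\stackrel\alpha\to z$ for some $z$ and all $y$ with $x_1\wedge x_2\stackrel\alpha\to y$ are in $F$, then $x_1\wedge x_2\in F$; if all $y$ with $x_1\wedge x_2\stackrel\epsilon\Longrightarrow|y$ are in $F$ then $x_1\wedge x_2\in F$; if $Y=t_Y\in E$ and $\langle t_Y|E\rangle\in F$ then $\langle Y|E\rangle\in F$; if all $y$ with $\langle Y|E\rangle\stackrel\epsilon\Longrightarrow|y$ are in $F$ then $\langle Y|E\rangle\in F$. -}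

module Defs where

open import Level using (0ℓ)
open import Data.Nat using (ℕ; _≡ᵇ_)
open import Data.Bool using (Bool; true; false; if_then_else_; _∧_; not)
open import Data.Product using (Σ; _×_; _,_; proj₁)
open import Data.Sum using (_⊎_)
open import Data.Unit.Polymorphic using (⊤)
open import Data.List using (List; []; _∷_; map; _++_)
open import Data.Bool.ListAction using (any)
open import Data.List.Membership.Propositional using (_∈_)
open import Data.List.Relation.Unary.Unique.Propositional using (Unique)
open import Relation.Nullary using (¬_)
open import Relation.Unary using (Pred)
open import Relation.Binary.Construct.Closure.ReflexiveTransitive using (Star)


module CLL (Act : Set) where

  data Label : Set where
    τ   : Label
    act : Act → Label

  Var : Set
  Var = ℕ

  -- A recursive specification is a finite list of equations
  -- (Y , t_Y); well-formedness (each variable defined once, X ∈ V,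
  -- guardedness) is imposed separately via WFT below.

  infixr 20 _∙_
  infixl 15 _□_ _∧ₜ_ _∨ₜ_

  data Term : Set₁ where
    𝟎    : Term
    ⊥ₜ   : Term
    _∙_  : Label → Term → Term
    _□_  : Term → Term → Term
    _∧ₜ_ : Term → Term → Term
    _∨ₜ_ : Term → Term → Term
    par  : Pred Act 0ℓ → Term → Term → Term
    var  : Var → Term
    ⟨_∣_⟩ : Var → List (Var × Term) → Term

  Spec : Set₁
  Spec = List (Var × Term)

  dom : Spec → List Var
  dom = map proj₁

  _∈ᵇ_ : Var → List Var → Bool
  Y ∈ᵇ B = any (Y ≡ᵇ_) B

  -- ⟨t|E⟩ : replace every free occurrence of Y ∈ dom E in t by ⟨Y|E⟩.
  -- B collects the variables bound by enclosing (inner) specifications.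

  mutual
    substT : Spec → List Var → Term → Term
    substT E B 𝟎 = 𝟎
    substT E B ⊥ₜ = ⊥ₜ
    substT E B (α ∙ t) = α ∙ substT E B t
    substT E B (t □ u) = substT E B t □ substT E B u
    substT E B (t ∧ₜ u) = substT E B t ∧ₜ substT E B u
    substT E B (t ∨ₜ u) = substT E B t ∨ₜ substT E B u
    substT E B (par A t u) = par A (substT E B t) (substT E B u)
    substT E B (var Y) =
      if (Y ∈ᵇ dom E) ∧ not (Y ∈ᵇ B) then ⟨ Y ∣ E ⟩ else var Y
    substT E B ⟨ Z ∣ E' ⟩ = ⟨ Z ∣ substS E (dom E' ++ B) E' ⟩

    substS : Spec → List Var → Spec → Spec
    substS E B [] = []
    substS E B ((Z , t) ∷ E') = (Z , substT E B t) ∷ substS E B E'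

  ⟪_∣_⟫ : Term → Spec → Term
  ⟪ t ∣ E ⟫ = substT E [] t

  data FreeOcc (Y : Var) : Term → Set₁ where
    var  : FreeOcc Y (var Y)
    pre  : ∀ {α t} → FreeOcc Y t → FreeOcc Y (α ∙ t)
    □l   : ∀ {t u} → FreeOcc Y t → FreeOcc Y (t □ u)
    □r   : ∀ {t u} → FreeOcc Y u → FreeOcc Y (t □ u)
    ∧l   : ∀ {t u} → FreeOcc Y t → FreeOcc Y (t ∧ₜ u)
    ∧r   : ∀ {t u} → FreeOcc Y u → FreeOcc Y (t ∧ₜ u)
    ∨l   : ∀ {t u} → FreeOcc Y t → FreeOcc Y (t ∨ₜ u)
    ∨r   : ∀ {t u} → FreeOcc Y u → FreeOcc Y (t ∨ₜ u)
    ∥l   : ∀ {A t u} → FreeOcc Y t → FreeOcc Y (par A t u)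
    ∥r   : ∀ {A t u} → FreeOcc Y u → FreeOcc Y (par A t u)
    rec  : ∀ {Z E Z' t} → ¬ (Y ∈ dom E) → (Z' , t) ∈ E →
           FreeOcc Y t → FreeOcc Y ⟨ Z ∣ E ⟩

  data UnguardedOcc (Y : Var) : Term → Set₁ where
    var  : UnguardedOcc Y (var Y)
    □l   : ∀ {t u} → UnguardedOcc Y t → UnguardedOcc Y (t □ u)
    □r   : ∀ {t u} → UnguardedOcc Y u → UnguardedOcc Y (t □ u)
    ∧l   : ∀ {t u} → UnguardedOcc Y t → UnguardedOcc Y (t ∧ₜ u)
    ∧r   : ∀ {t u} → UnguardedOcc Y u → UnguardedOcc Y (t ∧ₜ u)
    ∥l   : ∀ {A t u} → UnguardedOcc Y t → UnguardedOcc Y (par A t u)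
    ∥r   : ∀ {A t u} → UnguardedOcc Y u → UnguardedOcc Y (par A t u)
    rec  : ∀ {Z E Z' t} → ¬ (Y ∈ dom E) → (Z' , t) ∈ E →
           UnguardedOcc Y t → UnguardedOcc Y ⟨ Z ∣ E ⟩

  Closed : Term → Set₁
  Closed t = ∀ Y → ¬ FreeOcc Y t

  Guarded : Spec → Set₁
  Guarded E = ∀ {Y t} → (Y , t) ∈ E → ∀ Z → Z ∈ dom E → ¬ UnguardedOcc Z t

  WFSpec : Var → Spec → Set₁
  WFSpec X E = (X ∈ dom E) × Unique (dom E) × Guarded E

  mutual
    WFT : Term → Set₁
    WFT 𝟎 = ⊤
    WFT ⊥ₜ = ⊤
    WFT (α ∙ t) = WFT t
    WFT (t □ u) = WFT t × WFT u
    WFT (t ∧ₜ u) = WFT t × WFT u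
    WFT (t ∨ₜ u) = WFT t × WFT u
    WFT (par A t u) = WFT t × WFT u
    WFT (var Y) = ⊤
    WFT ⟨ X ∣ E ⟩ = WFSpec X E × WFS E

    WFS : Spec → Set₁
    WFS [] = ⊤
    WFS ((Z , t) ∷ E) = WFT t × WFS E

  Process : Term → Set₁
  Process t = Closed t × WFT t

  -- Stratum 0: τ-transitions (no negative premises).

  infix 4 _—τ→_ _—[_]→_ _⟶[_]_ _⇒ε∣_

  data _—τ→_ : Term → Term → Set₁ where
    pre : ∀ {x} → (τ ∙ x) —τ→ x
    □l  : ∀ {x₁ x₂ y₁} → x₁ —τ→ y₁ → (x₁ □ x₂) —τ→ (y₁ □ x₂)
    □r  : ∀ {x₁ x₂ y₁} → x₁ —τ→ y₁ → (x₂ □ x₁) —τ→ (x₂ □ y₁)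
    ∧l  : ∀ {x₁ x₂ y₁} → x₁ —τ→ y₁ → (x₁ ∧ₜ x₂) —τ→ (y₁ ∧ₜ x₂)
    ∧r  : ∀ {x₁ x₂ y₁} → x₁ —τ→ y₁ → (x₂ ∧ₜ x₁) —τ→ (x₂ ∧ₜ y₁)
    ∥l  : ∀ {A x₁ x₂ y₁} → x₁ —τ→ y₁ → par A x₁ x₂ —τ→ par A y₁ x₂
    ∥r  : ∀ {A x₁ x₂ y₁} → x₁ —τ→ y₁ → par A x₂ x₁ —τ→ par A x₂ y₁
    ∨l  : ∀ {x₁ x₂} → (x₁ ∨ₜ x₂) —τ→ x₁
    ∨r  : ∀ {x₁ x₂} → (x₁ ∨ₜ x₂) —τ→ x₂
    rec : ∀ {Y t E y} → (Y , t) ∈ E → ⟪ t ∣ E ⟫ —τ→ y → ⟨ Y ∣ E ⟩ —τ→ y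

  Stable : Term → Set₁
  Stable x = ∀ y → ¬ (x —τ→ y)

  -- Stratum 1: visible transitions.

  data _—[_]→_ : Term → Act → Term → Set₁ where
    pre  : ∀ {a x} → (act a ∙ x) —[ a ]→ x
    □l   : ∀ {a x₁ x₂ y₁} → x₁ —[ a ]→ y₁ → Stable x₂ → (x₁ □ x₂) —[ a ]→ y₁
    □r   : ∀ {a x₁ x₂ y₁} → x₁ —[ a ]→ y₁ → Stable x₂ → (x₂ □ x₁) —[ a ]→ y₁
    ∧b   : ∀ {a x₁ x₂ y₁ y₂} → x₁ —[ a ]→ y₁ → x₂ —[ a ]→ y₂ →
           (x₁ ∧ₜ x₂) —[ a ]→ (y₁ ∧ₜ y₂)
    ∥s   : ∀ {A a x₁ x₂ y₁ y₂} → A a → x₁ —[ a ]→ y₁ → x₂ —[ a ]→ y₂ →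
           par A x₁ x₂ —[ a ]→ par A y₁ y₂
    ∥l   : ∀ {A a x₁ x₂ y₁} → ¬ A a → x₁ —[ a ]→ y₁ → Stable x₂ →
           par A x₁ x₂ —[ a ]→ par A y₁ x₂
    ∥r   : ∀ {A a x₁ x₂ y₁} → ¬ A a → x₁ —[ a ]→ y₁ → Stable x₂ →
           par A x₂ x₁ —[ a ]→ par A x₂ y₁
    rec  : ∀ {a Y t E y} → (Y , t) ∈ E → ⟪ t ∣ E ⟫ —[ a ]→ y → ⟨ Y ∣ E ⟩ —[ a ]→ y

  _⟶[_]_ : Term → Label → Term → Set₁
  x ⟶[ τ ] y = x —τ→ y
  x ⟶[ act a ] y = x —[ a ]→ y

  _⇒ε∣_ : Term → Term → Set₁
  z ⇒ε∣ y = Star _—τ→_ z y × Stable y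

  HasAct : Term → Act → Set₁
  HasAct x a = Σ Term (λ y → x —[ a ]→ y)

  -- Stratum 2: the inconsistency predicate F (least set closed under
  -- the rules, given the transition relation of the lower strata).

  data F : Term → Set₁ where
    bot    : F ⊥ₜ
    pre    : ∀ {α x} → F x → F (α ∙ x)
    ∨b     : ∀ {x₁ x₂} → F x₁ → F x₂ → F (x₁ ∨ₜ x₂)
    □l     : ∀ {x₁ x₂} → F x₁ → F (x₁ □ x₂)
    □r     : ∀ {x₁ x₂} → F x₂ → F (x₁ □ x₂)
    ∥l     : ∀ {A x₁ x₂} → F x₁ → F (par A x₁ x₂)
    ∥r     : ∀ {A x₁ x₂} → F x₂ → F (par A x₁ x₂)
    ∧l     : ∀ {x₁ x₂} → F x₁ → F (x₁ ∧ₜ x₂)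
    ∧r     : ∀ {x₁ x₂} → F x₂ → F (x₁ ∧ₜ x₂)
    ∧ready : ∀ {x₁ x₂} a → Stable (x₁ ∧ₜ x₂) →
             ((HasAct x₁ a × ¬ HasAct x₂ a) ⊎ (HasAct x₂ a × ¬ HasAct x₁ a)) →
             F (x₁ ∧ₜ x₂)
    ∧step  : ∀ {x₁ x₂ z} α → (x₁ ∧ₜ x₂) ⟶[ α ] z →
             (∀ y → (x₁ ∧ₜ x₂) ⟶[ α ] y → F y) → F (x₁ ∧ₜ x₂)
    ∧div   : ∀ {x₁ x₂} → (∀ y → (x₁ ∧ₜ x₂) ⇒ε∣ y → F y) → F (x₁ ∧ₜ x₂)
    rec    : ∀ {Y t E} → (Y , t) ∈ E → F ⟪ t ∣ E ⟫ → F ⟨ Y ∣ E ⟩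
    recdiv : ∀ {Y E} → (∀ y → ⟨ Y ∣ E ⟩ ⇒ε∣ y → F y) → F ⟨ Y ∣ E ⟩

-- Items (1)–(5) are inversions of the rules for F.  The only τ-derivative
-- of ⟨X|X = τ.X⟩ is itself, so it has no stable ε-derivative and the
-- divergence rule for recursion gives (6) vacuously.  Item (7) goes by
-- induction on p: the divergence rules settle ∧ and ⟨X|E⟩, a state without
-- τ-steps is its own stable derivative, and τ-prefix and ∨ pass to their
-- τ-derivatives.  For p □ q and p ∥_A q, if both components reached
-- consistent stable states, their combination would be a consistent stable
-- derivative of the whole; so, classically, one component has only
-- inconsistent stable derivatives.  For (8), X has a unique equation in E,
-- and the divergence rule reduces to (7) for the unfolding ⟨t_X|E⟩, whose
-- τ-steps are exactly those of ⟨X|E⟩.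
module Submission where

open import Defs
open import Level using (suc; 0ℓ)
open import Data.Bool.Properties using (T-≡)
open import Data.Empty using (⊥-elim)
open import Data.List using ([]; _∷_)
open import Data.List.Membership.Propositional using (_∈_)
open import Data.List.Membership.Propositional.Properties using (∈-map⁺)
open import Data.List.Relation.Unary.AllPairs using (_∷_)
open import Data.List.Relation.Unary.Any using (here; there)
open import Data.List.Relation.Unary.Unique.Propositional using (Unique)
open import Data.List.Relation.Unary.Unique.Propositional.Properties
  using (Unique[x∷xs]⇒x∉xs)
open import Data.Nat.Properties using (≡⇒≡ᵇ)
open import Data.Product using (_×_; _,_; ∃; proj₁)
open import Data.Sum using (_⊎_; inj₁; inj₂; [_,_])
open import Function.Bundles using (_⇔_; mk⇔; Equivalence)
open import Relation.Binary.Construct.Closure.ReflexiveTransitive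
  using (Star; ε; _◅_; _◅◅_; gmap)
open import Relation.Binary.PropositionalEquality using (_≡_; refl; subst)
open import Relation.Nullary using (¬_; yes; no)
open import Relation.Unary using (Pred)
open import Axiom.ExcludedMiddle using (ExcludedMiddle)

module Inconsistency (Act : Set) where
  open CLL Act

  ∈-dom : ∀ {X t} {E : Spec} → (X , t) ∈ E → X ∈ dom E
  ∈-dom = ∈-map⁺ proj₁

  Unique-dom⇒equation-unique : ∀ {X t t'} {E : Spec} → Unique (dom E) →
    (X , t) ∈ E → (X , t') ∈ E → t ≡ t'
  Unique-dom⇒equation-unique _ (here refl) (here refl) = refl
  Unique-dom⇒equation-unique u (here refl) (there m) =
    ⊥-elim (Unique[x∷xs]⇒x∉xs u (∈-dom m))
  Unique-dom⇒equation-unique u (there m) (here refl) =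
    ⊥-elim (Unique[x∷xs]⇒x∉xs u (∈-dom m))
  Unique-dom⇒equation-unique (_ ∷ u) (there m) (there m') =
    Unique-dom⇒equation-unique u m m'

  F-∨⁻ : ∀ {p q} → F (p ∨ₜ q) → F p × F q
  F-∨⁻ (∨b f g) = f , g

  F-∙⁻ : ∀ {α p} → F (α ∙ p) → F p
  F-∙⁻ (pre f) = f

  F-□⁻ : ∀ {p q} → F (p □ q) → F p ⊎ F q
  F-□⁻ (□l f) = inj₁ f
  F-□⁻ (□r f) = inj₂ f

  F-□⁺ : ∀ {p q} → F p ⊎ F q → F (p □ q)
  F-□⁺ (inj₁ f) = □l f
  F-□⁺ (inj₂ f) = □r f

  F-par⁻ : ∀ {A p q} → F (par A p q) → F p ⊎ F q
  F-par⁻ (∥l f) = inj₁ f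
  F-par⁻ (∥r f) = inj₂ f

  F-par⁺ : ∀ {A p q} → F p ⊎ F q → F (par A p q)
  F-par⁺ (inj₁ f) = ∥l f
  F-par⁺ (inj₂ f) = ∥r f

  F-∧⁺ : ∀ {p q} → F p ⊎ F q → F (p ∧ₜ q)
  F-∧⁺ (inj₁ f) = ∧l f
  F-∧⁺ (inj₂ f) = ∧r f

  ¬F-𝟎 : ¬ F 𝟎
  ¬F-𝟎 ()

  AllF⇒ε∣ : Term → Set₁
  AllF⇒ε∣ p = ∀ q → p ⇒ε∣ q → F q

  ReachesConsistent : Term → Set₁
  ReachesConsistent p = ∃ λ q → p ⇒ε∣ q × ¬ F q

  AllF⇒ε∣⇒¬ReachesConsistent : ∀ {p} → AllF⇒ε∣ p → ¬ ReachesConsistent p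
  AllF⇒ε∣⇒¬ReachesConsistent h (q , d , ¬f) = ¬f (h q d)

  ¬ReachesConsistent⇒AllF⇒ε∣ : ExcludedMiddle (suc 0ℓ) →
    ∀ {p} → ¬ ReachesConsistent p → AllF⇒ε∣ p
  ¬ReachesConsistent⇒AllF⇒ε∣ em {p} ¬r q d with em {F q}
  ... | yes f = f
  ... | no ¬f = ⊥-elim (¬r (q , d , ¬f))

  AllF⇒ε∣-τ-step : ∀ {p p'} → p —τ→ p' → AllF⇒ε∣ p → AllF⇒ε∣ p'
  AllF⇒ε∣-τ-step s h q (ss , st) = h q (s ◅ ss , st)

  Stable⇒AllF⇒ε∣⇒F : ∀ {p} → Stable p → AllF⇒ε∣ p → F p
  Stable⇒AllF⇒ε∣⇒F st h = h _ (ε , st)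

  module ReachesConsistentCong
    (_⊙_ : Term → Term → Term)
    (τ-congˡ : ∀ {p p' q} → p —τ→ p' → (p ⊙ q) —τ→ (p' ⊙ q))
    (τ-congʳ : ∀ {p q q'} → q —τ→ q' → (p ⊙ q) —τ→ (p ⊙ q'))
    (Stable-⊙ : ∀ {p q} → Stable p → Stable q → Stable (p ⊙ q))
    (F-⊙⁻ : ∀ {p q} → F (p ⊙ q) → F p ⊎ F q)
    where

    ReachesConsistent-⊙ : ∀ {p q} → ReachesConsistent p → ReachesConsistent q →
      ReachesConsistent (p ⊙ q)
    ReachesConsistent-⊙ (p' , (sp , stp) , ¬fp) (q' , (sq , stq) , ¬fq) =
        p' ⊙ q'
      , (gmap (_⊙ _) τ-congˡ sp ◅◅ gmap (_ ⊙_) τ-congʳ sq , Stable-⊙ stp stq)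
      , λ f → [ ¬fp , ¬fq ] (F-⊙⁻ f)

  Stable-□ : ∀ {p q} → Stable p → Stable q → Stable (p □ q)
  Stable-□ st _ _ (□l s) = st _ s
  Stable-□ _ st _ (□r s) = st _ s

  Stable-par : ∀ {A p q} → Stable p → Stable q → Stable (par A p q)
  Stable-par st _ _ (∥l s) = st _ s
  Stable-par _ st _ (∥r s) = st _ s

  open ReachesConsistentCong using (ReachesConsistent-⊙)

  ReachesConsistent-□ : ∀ {p q} → ReachesConsistent p → ReachesConsistent q →
    ReachesConsistent (p □ q)
  ReachesConsistent-□ = ReachesConsistent-⊙ _□_ □l □r Stable-□ F-□⁻

  ReachesConsistent-par : ∀ {A p q} → ReachesConsistent p → ReachesConsistent q →
    ReachesConsistent (par A p q)
  ReachesConsistent-par {A} = ReachesConsistent-⊙ (par A) ∥l ∥r Stable-par F-par⁻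

  AllF⇒ε∣⇒F : ExcludedMiddle (suc 0ℓ) → ∀ p → AllF⇒ε∣ p → F p
  AllF⇒ε∣⇒F em 𝟎 = Stable⇒AllF⇒ε∣⇒F λ _ ()
  AllF⇒ε∣⇒F em ⊥ₜ = Stable⇒AllF⇒ε∣⇒F λ _ ()
  AllF⇒ε∣⇒F em (act a ∙ p) = Stable⇒AllF⇒ε∣⇒F λ _ ()
  AllF⇒ε∣⇒F em (var X) = Stable⇒AllF⇒ε∣⇒F λ _ ()
  AllF⇒ε∣⇒F em (τ ∙ p) h = pre (AllF⇒ε∣⇒F em p (AllF⇒ε∣-τ-step pre h))
  AllF⇒ε∣⇒F em (p ∨ₜ q) h =
    ∨b (AllF⇒ε∣⇒F em p (AllF⇒ε∣-τ-step ∨l h))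
       (AllF⇒ε∣⇒F em q (AllF⇒ε∣-τ-step ∨r h))
  AllF⇒ε∣⇒F em (p ∧ₜ q) = ∧div
  AllF⇒ε∣⇒F em ⟨ X ∣ E ⟩ = recdiv
  AllF⇒ε∣⇒F em (p □ q) h with em {ReachesConsistent p} | em {ReachesConsistent q}
  ... | no ¬rp | _ = □l (AllF⇒ε∣⇒F em p (¬ReachesConsistent⇒AllF⇒ε∣ em ¬rp))
  ... | yes _ | no ¬rq = □r (AllF⇒ε∣⇒F em q (¬ReachesConsistent⇒AllF⇒ε∣ em ¬rq))
  ... | yes rp | yes rq =
    ⊥-elim (AllF⇒ε∣⇒¬ReachesConsistent h (ReachesConsistent-□ rp rq))
  AllF⇒ε∣⇒F em (par A p q) h with em {ReachesConsistent p} | em {ReachesConsistent q}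
  ... | no ¬rp | _ = ∥l (AllF⇒ε∣⇒F em p (¬ReachesConsistent⇒AllF⇒ε∣ em ¬rp))
  ... | yes _ | no ¬rq = ∥r (AllF⇒ε∣⇒F em q (¬ReachesConsistent⇒AllF⇒ε∣ em ¬rq))
  ... | yes rp | yes rq =
    ⊥-elim (AllF⇒ε∣⇒¬ReachesConsistent h (ReachesConsistent-par rp rq))

  Stable-unfold⇒Stable-rec : ∀ {X t} {E : Spec} → Unique (dom E) →
    (X , t) ∈ E → Stable ⟪ t ∣ E ⟫ → Stable ⟨ X ∣ E ⟩
  Stable-unfold⇒Stable-rec {E = E} u m st y (rec m' s) =
    st y (subst (λ v → ⟪ v ∣ E ⟫ —τ→ y) (Unique-dom⇒equation-unique u m' m) s)

  F-rec⁻ : ExcludedMiddle (suc 0ℓ) → ∀ {X t} {E : Spec} → Unique (dom E) →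
    (X , t) ∈ E → F ⟨ X ∣ E ⟩ → F ⟪ t ∣ E ⟫
  F-rec⁻ em {E = E} u m (rec m' f) =
    subst (λ v → F ⟪ v ∣ E ⟫) (Unique-dom⇒equation-unique u m' m) f
  F-rec⁻ em {X} {t} {E} u m (recdiv h) = AllF⇒ε∣⇒F em ⟪ t ∣ E ⟫ unfold-AllF
    where
    unfold-AllF : AllF⇒ε∣ ⟪ t ∣ E ⟫
    unfold-AllF _ (ε , st) =
      F-rec⁻ em u m (h ⟨ X ∣ E ⟩ (ε , Stable-unfold⇒Stable-rec u m st))
    unfold-AllF q (s ◅ ss , st) = h q (rec m s ◅ ss , st)

  τ-loop : Var → Term
  τ-loop X = ⟨ X ∣ (X , τ ∙ var X) ∷ [] ⟩

  τ-loop-unfold : ∀ X → ⟪ var X ∣ (X , τ ∙ var X) ∷ [] ⟫ ≡ τ-loop X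
  τ-loop-unfold X rewrite Equivalence.to T-≡ (≡⇒≡ᵇ X X refl) = refl

  τ-loop-step : ∀ X → τ-loop X —τ→ τ-loop X
  τ-loop-step X =
    rec (here refl) (subst (τ ∙ ⟪ var X ∣ _ ⟫ —τ→_) (τ-loop-unfold X) pre)

  τ-loop-step-unique : ∀ {X y} → τ-loop X —τ→ y → y ≡ τ-loop X
  τ-loop-step-unique (rec (here refl) pre) = τ-loop-unfold _

  τ-loop-diverges : ∀ {X x y} → x ≡ τ-loop X → Star _—τ→_ x y → ¬ Stable y
  τ-loop-diverges refl ε st = st _ (τ-loop-step _)
  τ-loop-diverges refl (s ◅ ss) = τ-loop-diverges (τ-loop-step-unique s) ss

  F-τ-loop : ∀ X → F (τ-loop X)
  F-τ-loop X = recdiv λ _ (ss , st) → ⊥-elim (τ-loop-diverges refl ss st)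

mainTheorem7 : (Act : Set) → let open CLL Act in
    (∀ p q → Process p → Process q → F (p ∨ₜ q) ⇔ (F p × F q))
    × (∀ (α : Label) p → Process p → F (α ∙ p) ⇔ F p)
    × (∀ p q → Process p → Process q → F (p □ q) ⇔ (F p ⊎ F q))
    × (∀ (A : Pred Act 0ℓ) p q → Process p → Process q →
         F (par A p q) ⇔ (F p ⊎ F q))
    × (∀ p q → Process p → Process q → (F p ⊎ F q) → F (p ∧ₜ q))
    × (¬ F 𝟎 × F ⊥ₜ)
    × (∀ (X : Var) → F ⟨ X ∣ (X , τ ∙ var X) ∷ [] ⟩)
    × (ExcludedMiddle (suc 0ℓ) →
         ∀ p → Process p → (∀ q → p ⇒ε∣ q → F q) → F p)
    × (ExcludedMiddle (suc 0ℓ) →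
         ∀ (X : Var) (E : Spec) t → Process ⟨ X ∣ E ⟩ → (X , t) ∈ E →
           F ⟨ X ∣ E ⟩ ⇔ F ⟪ t ∣ E ⟫)
mainTheorem7 Act =
    (λ _ _ _ _ → mk⇔ F-∨⁻ λ (f , g) → ∨b f g)
  , (λ _ _ _ → mk⇔ F-∙⁻ pre)
  , (λ _ _ _ _ → mk⇔ F-□⁻ F-□⁺)
  , (λ _ _ _ _ _ → mk⇔ F-par⁻ F-par⁺)
  , (λ _ _ _ _ → F-∧⁺)
  , (¬F-𝟎 , bot)
  , F-τ-loop
  , (λ em p _ → AllF⇒ε∣⇒F em p)
  , (λ em _ _ _ (_ , (_ , uniqueDom , _) , _) m → mk⇔ (F-rec⁻ em uniqueDom m) (rec m))
  where
  open CLL Act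
  open Inconsistency Act
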